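{- If $t$ is a lambda-term in $\beta$-normal form, then $[\![T]\!](t)$ is $T$-normal.
   Context: Lambda-terms are considered up to $\alpha$-equivalence; $\mathrm{FV}(t)$ is the set of free variables of $t$. Fix the combinators $\mathsf{S}=\lambda xyz.xz(yz)$, $\mathsf{K}=\lambda xy.x$, $\mathsf{I}=\lambda x.x$, $\mathsf{B}=\lambda xyz.x(yz)$, $\mathsf{C}=\lambda xyz.xzy$, $\mathsf{S}'=\lambda kxyz.k(xz)(yz)$, $\mathsf{B}'=\lambda kxyz.kx(yz)$, $\mathsf{C}'=\lambda kxyz.k(xz)y$. Let $\mathcal{B}=\{\mathsf{S},\mathsf{K},\mathsf{I},\mathsf{B},\mathsf{C},\mathsf{S}',\mathsf{B}',\mathsf{C}'\}$ and let $\mathrm{CL}(\mathcal{B})$ be the set of terms built from variables and elements of $\mathcal{B}$ using only application (left-associative); equality of such terms is syntactic, combinators treated as atoms. A term is $T$-normal if it contains no subterm of the form $\mathsf{K}t_1t_2$, $\mathsf{I}t$, $\mathsf{B}t_1t_2t_3$ or $\mathsf{B}'t_1t_2t_3t_4$. Algorithm $T$: for a variable $x$ and $t\in\mathrm{CL}(\mathcal{B})$, $[x]_T t$ is given by the first applicable equation: (1) $[x]_T t=\mathsf{K}t$ if $x\notin\mathrm{FV}(t)$; (2) $[x]_T x=\mathsf{I}$; (3) $[x]_T (s x)=s$ if $x\notin\mathrm{FV}(s)$; (4) $[x]_T (u x t)=\mathsf{C}ut$ if $x\notin\mathrm{FV}(ut)$; (5) $[x]_T (u x t)=\mathsf{S}u([x]_T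 t)$ if $x\notin\mathrm{FV}(u)$; (6) $[x]_T (u s t)=\mathsf{B}'us([x]_T t)$ if $x\notin\mathrm{FV}(us)$; (7) $[x]_T (u s t)=\mathsf{C}'u([x]_T s)t$ if $x\notin\mathrm{FV}(ut)$; (8) $[x]_T (u s t)=\mathsf{S}'u([x]_T s)([x]_T t)$ if $x\notin\mathrm{FV}(u)$; (9) $[x]_T (s t)=\mathsf{B}s([x]_T t)$ if $x\notin\mathrm{FV}(s)$; (10) $[x]_T (s t)=\mathsf{C}([x]_T s)t$ if $x\notin\mathrm{FV}(t)$; (11) $[x]_T (s t)=\mathsf{S}([x]_T s)([x]_T t)$. The induced translation $[\![T]\!]$ from lambda-terms to $\mathrm{CL}(\mathcal{B})$ is defined by $[\![T]\!](x)=x$, $[\![T]\!](st)=[\![T]\!](s)\,[\![T]\!](t)$, $[\![T]\!](\lambda x.t)=[x]_T([\![T]\!](t))$. -}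

module Defs where

open import Data.Nat using (ℕ; _≡ᵇ_)
open import Data.Bool using (Bool; true; false; not; _∧_; _∨_; if_then_else_)
open import Relation.Nullary using (¬_)

data Λ : Set where
  var : ℕ → Λ
  _·_ : Λ → Λ → Λ
  ƛ   : ℕ → Λ → Λ

infixl 7 _·_

data HasRedex : Λ → Set where
  redex : ∀ x s u → HasRedex (ƛ x s · u)
  appˡ  : ∀ {s u} → HasRedex s → HasRedex (s · u)
  appʳ  : ∀ {s u} → HasRedex u → HasRedex (s · u)
  lam   : ∀ {x s} → HasRedex s → HasRedex (ƛ x s)

BetaNormal : Λ → Set
BetaNormal t = ¬ HasRedex t

data Comb : Set where
  S K I B C S′ B′ C′ : Comb

data CL : Set where
  v   : ℕ → CL
  c   : Comb → CL
  _∙_ : CL → CL → CL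

infixl 7 _∙_

occ : ℕ → CL → Bool
occ x (v y)   = x ≡ᵇ y
occ x (c _)   = false
occ x (s ∙ t) = occ x s ∨ occ x t

notin : ℕ → CL → Bool
notin x t = not (occ x t)

isVar : ℕ → CL → Bool
isVar x (v y) = x ≡ᵇ y
isVar x _     = false

[_]T_ : ℕ → CL → CL
[ x ]T t with notin x t
... | true = c K ∙ t                                       -- (1)
[ x ]T v y | false = c I                                   -- (2) (here y = x)
[ x ]T c k | false = c K ∙ c k                             -- unreachable
[ x ]T (us@(u ∙ s) ∙ t) | false =
  if isVar x t ∧ notin x us then us                        -- (3)
  else if isVar x s ∧ notin x u ∧ notin x t then c C ∙ u ∙ t   -- (4)
  else if isVar x s ∧ notin x u then c S ∙ u ∙ ([ x ]T t)      -- (5)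
  else if notin x u ∧ notin x s then c B′ ∙ u ∙ s ∙ ([ x ]T t) -- (6)
  else if notin x u ∧ notin x t then c C′ ∙ u ∙ ([ x ]T s) ∙ t -- (7)
  else if notin x u then c S′ ∙ u ∙ ([ x ]T s) ∙ ([ x ]T t)    -- (8)
  else if notin x us then c B ∙ us ∙ ([ x ]T t)                -- (9)
  else if notin x t then c C ∙ ([ x ]T us) ∙ t                 -- (10)
  else c S ∙ ([ x ]T us) ∙ ([ x ]T t)                          -- (11)
[ x ]T (s ∙ t) | false =
  -- s is a variable or a combinator, so (4)-(8) cannot apply
  if isVar x t ∧ notin x s then s                          -- (3)
  else if notin x s then c B ∙ s ∙ ([ x ]T t)              -- (9)
  else if notin x t then c C ∙ ([ x ]T s) ∙ t              -- (10)
  else c S ∙ ([ x ]T s) ∙ ([ x ]T t)                       -- (11)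

⟦T⟧ : Λ → CL
⟦T⟧ (var x) = v x
⟦T⟧ (s · t) = ⟦T⟧ s ∙ ⟦T⟧ t
⟦T⟧ (ƛ x t) = [ x ]T (⟦T⟧ t)

data HasTRedex : CL → Set where
  K-redex  : ∀ t₁ t₂ → HasTRedex (c K ∙ t₁ ∙ t₂)
  I-redex  : ∀ t → HasTRedex (c I ∙ t)
  B-redex  : ∀ t₁ t₂ t₃ → HasTRedex (c B ∙ t₁ ∙ t₂ ∙ t₃)
  B′-redex : ∀ t₁ t₂ t₃ t₄ → HasTRedex (c B′ ∙ t₁ ∙ t₂ ∙ t₃ ∙ t₄)
  appˡ     : ∀ {s t} → HasTRedex s → HasTRedex (s ∙ t)
  appʳ     : ∀ {s t} → HasTRedex t → HasTRedex (s ∙ t)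

TNormal : CL → Set
TNormal t = ¬ HasTRedex t

-- Every clause of algorithm T builds a combinator applied
-- to fewer arguments than it needs to fire (K to one, B to two, B′ to three) or
-- one that never fires, so abstraction preserves T-normality.  In a β-normal term
-- the head of every application is a variable, and applying a variable-headed term
-- creates no T-redex; the theorem follows by induction on the term.
module Submission where

open import Defs
open import Data.Nat using (ℕ)
open import Data.Bool using (if_then_else_; true; false; _∧_)
open import Data.Empty using (⊥-elim)
open import Data.Sum using (_⊎_; inj₁; inj₂; [_,_])
open import Function using (_∘_)
open import Relation.Binary.PropositionalEquality using (_≢_; refl)

if-preserves : ∀ {A : Set} (P : A → Set) b {x y : A} →
               P x → P y → P (if b then x else y)
if-preserves P true  px py = px
if-preserves P false px py = py

Inert : CL → Set
Inert s = ∀ {t} → HasTRedex (s ∙ t) → HasTRedex s ⊎ HasTRedex t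

∙-TNormal : ∀ {s t} → Inert s → TNormal s → TNormal t → TNormal (s ∙ t)
∙-TNormal inert ns nt = [ ns , nt ] ∘ inert

c-TNormal : ∀ k → TNormal (c k)
c-TNormal k ()

c-inert : ∀ {k} → k ≢ I → Inert (c k)
c-inert k≢I (I-redex _) = ⊥-elim (k≢I refl)
c-inert k≢I (appˡ h)    = inj₁ h
c-inert k≢I (appʳ h)    = inj₂ h

c∙-inert : ∀ {k a} → k ≢ K → Inert (c k ∙ a)
c∙-inert k≢K (K-redex _ _) = ⊥-elim (k≢K refl)
c∙-inert k≢K (appˡ h)      = inj₁ h
c∙-inert k≢K (appʳ h)      = inj₂ h

c∙∙-inert : ∀ {k a b} → k ≢ B → Inert (c k ∙ a ∙ b)
c∙∙-inert k≢B (B-redex _ _ _) = ⊥-elim (k≢B refl)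
c∙∙-inert k≢B (appˡ h)        = inj₁ h
c∙∙-inert k≢B (appʳ h)        = inj₂ h

c∙∙∙-inert : ∀ {k a b d} → k ≢ B′ → Inert (c k ∙ a ∙ b ∙ d)
c∙∙∙-inert k≢B′ (B′-redex _ _ _ _) = ⊥-elim (k≢B′ refl)
c∙∙∙-inert k≢B′ (appˡ h)           = inj₁ h
c∙∙∙-inert k≢B′ (appʳ h)           = inj₂ h

c∙-TNormal : ∀ {k a} → k ≢ I → TNormal a → TNormal (c k ∙ a)
c∙-TNormal k≢I = ∙-TNormal (c-inert k≢I) (c-TNormal _)

c∙∙-TNormal : ∀ {k a b} → k ≢ I → k ≢ K →
              TNormal a → TNormal b → TNormal (c k ∙ a ∙ b)
c∙∙-TNormal k≢I k≢K na = ∙-TNormal (c∙-inert k≢K) (c∙-TNormal k≢I na)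

c∙∙∙-TNormal : ∀ {k a b d} → k ≢ I → k ≢ K → k ≢ B →
               TNormal a → TNormal b → TNormal d → TNormal (c k ∙ a ∙ b ∙ d)
c∙∙∙-TNormal k≢I k≢K k≢B na nb =
  ∙-TNormal (c∙∙-inert k≢B) (c∙∙-TNormal k≢I k≢K na nb)

K∙-TNormal : ∀ {a} → TNormal a → TNormal (c K ∙ a)
K∙-TNormal = c∙-TNormal (λ ())

C∙∙-TNormal : ∀ {a b} → TNormal a → TNormal b → TNormal (c C ∙ a ∙ b)
C∙∙-TNormal = c∙∙-TNormal (λ ()) (λ ())

S∙∙-TNormal : ∀ {a b} → TNormal a → TNormal b → TNormal (c S ∙ a ∙ b)
S∙∙-TNormal = c∙∙-TNormal (λ ()) (λ ())

B∙∙-TNormal : ∀ {a b} → TNormal a → TNormal b → TNormal (c B ∙ a ∙ b)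
B∙∙-TNormal = c∙∙-TNormal (λ ()) (λ ())

B′∙∙∙-TNormal : ∀ {a b d} → TNormal a → TNormal b → TNormal d → TNormal (c B′ ∙ a ∙ b ∙ d)
B′∙∙∙-TNormal = c∙∙∙-TNormal (λ ()) (λ ()) (λ ())

C′∙∙∙-TNormal : ∀ {a b d} → TNormal a → TNormal b → TNormal d → TNormal (c C′ ∙ a ∙ b ∙ d)
C′∙∙∙-TNormal = c∙∙∙-TNormal (λ ()) (λ ()) (λ ())

S′∙∙∙-TNormal : ∀ {a b d} → TNormal a → TNormal b → TNormal d → TNormal (c S′ ∙ a ∙ b ∙ d)
S′∙∙∙-TNormal = c∙∙∙-TNormal (λ ()) (λ ()) (λ ())

module _ (x : ℕ) where

  private
    preserves : ∀ b {s t} → TNormal s → TNormal t → TNormal (if b then s else t)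
    preserves = if-preserves TNormal

  clauses-9-11-TNormal : ∀ s t → TNormal s → TNormal t →
    TNormal ([ x ]T s) → TNormal ([ x ]T t) →
    TNormal (if notin x s then c B ∙ s ∙ ([ x ]T t)
             else if notin x t then c C ∙ ([ x ]T s) ∙ t
             else c S ∙ ([ x ]T s) ∙ ([ x ]T t))
  clauses-9-11-TNormal s t ns nt nxs nxt =
    preserves (notin x s) (B∙∙-TNormal ns nxt)
    (preserves (notin x t) (C∙∙-TNormal nxs nt)
    (S∙∙-TNormal nxs nxt))

  clauses-3-9-11-TNormal : ∀ s t → TNormal (s ∙ t) →
    TNormal ([ x ]T s) → TNormal ([ x ]T t) →
    TNormal (if isVar x t ∧ notin x s then s
             else if notin x s then c B ∙ s ∙ ([ x ]T t)
             else if notin x t then c C ∙ ([ x ]T s) ∙ t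
             else c S ∙ ([ x ]T s) ∙ ([ x ]T t))
  clauses-3-9-11-TNormal s t nst nxs nxt =
    preserves (isVar x t ∧ notin x s) (nst ∘ appˡ)
    (clauses-9-11-TNormal s t (nst ∘ appˡ) (nst ∘ appʳ) nxs nxt)

  abstraction-TNormal : ∀ t → TNormal t → TNormal ([ x ]T t)
  abstraction-TNormal t nt with notin x t
  ... | true = K∙-TNormal nt
  abstraction-TNormal (v y) _ | false = c-TNormal I
  abstraction-TNormal (c k) _ | false = K∙-TNormal (c-TNormal k)
  abstraction-TNormal (us@(u ∙ s) ∙ t) nust | false =
    preserves (isVar x t ∧ notin x us) nus
    (preserves (isVar x s ∧ notin x u ∧ notin x t) (C∙∙-TNormal nu nt)
    (preserves (isVar x s ∧ notin x u) (S∙∙-TNormal nu nxt)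
    (preserves (notin x u ∧ notin x s) (B′∙∙∙-TNormal nu ns nxt)
    (preserves (notin x u ∧ notin x t) (C′∙∙∙-TNormal nu nxs nt)
    (preserves (notin x u) (S′∙∙∙-TNormal nu nxs nxt)
    (clauses-9-11-TNormal us t nus nt (abstraction-TNormal us nus) nxt))))))
    where
    nus : TNormal us
    nus = nust ∘ appˡ
    nt : TNormal t
    nt = nust ∘ appʳ
    nu : TNormal u
    nu = nus ∘ appˡ
    ns : TNormal s
    ns = nus ∘ appʳ
    nxs : TNormal ([ x ]T s)
    nxs = abstraction-TNormal s ns
    nxt : TNormal ([ x ]T t)
    nxt = abstraction-TNormal t nt
  abstraction-TNormal (v y ∙ t) nyt | false =
    clauses-3-9-11-TNormal (v y) t nyt
      (abstraction-TNormal (v y) (nyt ∘ appˡ)) (abstraction-TNormal t (nyt ∘ appʳ))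
  abstraction-TNormal (c k ∙ t) nkt | false =
    clauses-3-9-11-TNormal (c k) t nkt
      (abstraction-TNormal (c k) (nkt ∘ appˡ)) (abstraction-TNormal t (nkt ∘ appʳ))

data VarHeaded : CL → Set where
  var : ∀ y → VarHeaded (v y)
  app : ∀ {s t} → VarHeaded s → VarHeaded (s ∙ t)

VarHeaded-inert : ∀ {s} → VarHeaded s → Inert s
VarHeaded-inert (app ())              (K-redex _ _)
VarHeaded-inert (app (app ()))        (B-redex _ _ _)
VarHeaded-inert (app (app (app ())))  (B′-redex _ _ _ _)
VarHeaded-inert _ (appˡ h) = inj₁ h
VarHeaded-inert _ (appʳ h) = inj₂ h

⟦T⟧-operator-VarHeaded : ∀ s u → BetaNormal (s · u) → VarHeaded (⟦T⟧ s)
⟦T⟧-operator-VarHeaded (var y)  u β = var y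
⟦T⟧-operator-VarHeaded (s · s′) u β = app (⟦T⟧-operator-VarHeaded s s′ (β ∘ appˡ))
⟦T⟧-operator-VarHeaded (ƛ x s)  u β = ⊥-elim (β (redex x s u))

mainTheorem12 : (t : Λ) → BetaNormal t → TNormal (⟦T⟧ t)
mainTheorem12 (var x) β ()
mainTheorem12 (s · u) β =
  ∙-TNormal (VarHeaded-inert (⟦T⟧-operator-VarHeaded s u β))
            (mainTheorem12 s (β ∘ appˡ))
            (mainTheorem12 u (β ∘ appʳ))
mainTheorem12 (ƛ x t) β = abstraction-TNormal x (⟦T⟧ t) (mainTheorem12 t (β ∘ lam))
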